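{- The following algorithm for $\operatorname{AND}$ is correct: on input lists $A_0,\dots,A_{m-1}$ its successive calls to next return, each exactly once, precisely the intervals of $\operatorname{AND}(A_0,\dots,A_{m-1})$, and then $\text{null}$. Algorithm: maintain a reference array holding one current interval per input list, and an indirect priority queue $Q$ of list indices ordered by $\preceq$ applied to the current intervals; also maintain the right extreme of $Q$, namely the maximum of the right extremes of all intervals read so far into the reference array. $Q$ is full if it contains all $m$ indices; span$(Q)$ is the interval whose left extreme is the left extreme of top$(Q)$ (the current interval of the top index) and whose right extreme is the right extreme of $Q$. Initially the first interval of each $A_i$ is read, $Q$ contains all indices, and $c\leftarrow[-\infty\..-\infty]$. advance$(Q)$: with $i$ the top index, if $A_i$ is not exhausted read its next interval into the reference array (updating $Q$ and its right extreme), otherwise remove $i$ from $Q$. next: while $Q$ is full and $c\subseteq$ span$(Q)$, do advance$(Q)$; if $Q$ is not full return $\text{null}$; then repeat \{ $c\leftarrow$ span$(Q)$; if $c=$ top$(Q)$ return $c$; advance$(Q)$ \} as long as $Q$ is full and span$(Q)\subseteq c$; finally return $c$.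
   Context: Let $O$ be a finite totally ordered set accessed only via comparisons; $\pm\infty$ denote special elements strictly smaller/larger than every element of $O$. A subset $X\subseteq O$ is an interval if $x,y\in X$, $x<z<y$ imply $z\in X$; nonempty intervals are written $[\ell\..r]$. The interval spanned by a family of intervals is the least interval containing all of them. An antichain of intervals is a set of intervals pairwise incomparable under inclusion, listed in natural order (by left extreme, equivalently right extreme). The input consists of $m$ lists $A_0,\dots,A_{m-1}$, each a nonempty antichain of nonempty intervals delivered in natural order via a next function returning $\text{null}$ once exhausted. $\operatorname{AND}(A_0,\dots,A_{m-1})$ is the set of inclusion-minimal intervals among the intervals spanned by tuples in $A_0\times\dots\times A_{m-1}$. The priority order $\preceq$ is: $[\ell\..r]\preceq[\ell'\..r']$ iff $\ell<\ell'$, or $\ell=\ell'$ and $r\ge r'$; the top of $Q$ is the index whose current interval is $\preceq$-least. -}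

module Defs where

open import Data.Nat using (ℕ; zero; suc; _+_)
open import Data.Bool using (Bool; true; false; _∧_; not; if_then_else_)
open import Data.Fin using (Fin; zero; suc)
import Data.Fin as Fin
open import Data.List using (List; []; _∷_; length)
open import Data.List.NonEmpty using (List⁺; head; tail; toList)
open import Data.List.Membership.Propositional using (_∈_)
open import Data.List.Relation.Unary.AllPairs using (AllPairs)
open import Data.Maybe using (Maybe; just; nothing)
open import Data.Product using (_×_; _,_; proj₁; proj₂; Σ)
open import Data.Sum using (_⊎_)
open import Function using (_∘_)
open import Relation.Nullary using (¬_; does)
open import Relation.Binary.PropositionalEquality using (_≡_)
open import Relation.Binary.Structures using (IsStrictTotalOrder)

module AND {O : Set} {_<_ : O → O → Set}
           (sto : IsStrictTotalOrder _≡_ _<_) where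

  open IsStrictTotalOrder sto using (_<?_)

  _≤_ : O → O → Set
  x ≤ y = x < y ⊎ x ≡ y

  -- a nonempty interval [ℓ..r] is represented by the pair (ℓ , r)
  Iv : Set
  Iv = O × O

  NonEmptyIv : Iv → Set
  NonEmptyIv (l , r) = l ≤ r

  _⊆_ : Iv → Iv → Set
  (l , r) ⊆ (l' , r') = (l' ≤ l) × (r ≤ r')

  NatAntichain : List Iv → Set
  NatAntichain = AllPairs (λ a b → (¬ (a ⊆ b)) × (¬ (b ⊆ a)) × (proj₁ a < proj₁ b))

  SpannedBy : ∀ {m} → (Fin m → Iv) → Iv → Set
  SpannedBy t I = (∀ i → t i ⊆ I) × (∀ J → (∀ i → t i ⊆ J) → I ⊆ J)

  Spanned : ∀ {m} → (Fin m → List⁺ Iv) → Iv → Set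
  Spanned {m} A I = Σ (Fin m → Iv) λ t → (∀ i → t i ∈ toList (A i)) × SpannedBy t I

  InAND : ∀ {m} → (Fin m → List⁺ Iv) → Iv → Set
  InAND A I = Spanned A I × (∀ J → Spanned A J → J ⊆ I → J ≡ I)

  _⪯_ : Iv → Iv → Set
  (l , r) ⪯ (l' , r') = l < l' ⊎ ((l ≡ l') × (r' ≤ r))

  data Ext : Set where
    -∞ : Ext
    ι  : O → Ext
    +∞ : Ext

  _<ᵇ_ : O → O → Bool
  a <ᵇ b = does (a <? b)

  _≤ᵉ_ : Ext → Ext → Bool
  -∞ ≤ᵉ _ = true
  ι _ ≤ᵉ -∞ = false
  ι a ≤ᵉ ι b = not (b <ᵇ a)
  ι _ ≤ᵉ +∞ = true
  +∞ ≤ᵉ -∞ = false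
  +∞ ≤ᵉ ι _ = false
  +∞ ≤ᵉ +∞ = true

  _≡ᵉ_ : Ext → Ext → Bool
  a ≡ᵉ b = (a ≤ᵉ b) ∧ (b ≤ᵉ a)

  maxE : Ext → Ext → Ext
  maxE a b = if a ≤ᵉ b then b else a

  EIv : Set
  EIv = Ext × Ext

  _⊆ᵇ_ : EIv → EIv → Bool
  (l , r) ⊆ᵇ (l' , r') = (l' ≤ᵉ l) ∧ (r ≤ᵉ r')

  _==ᵇ_ : EIv → EIv → Bool
  (l , r) ==ᵇ (l' , r') = (l ≡ᵉ l') ∧ (r ≡ᵉ r')

  liftIv : Iv → EIv
  liftIv (l , r) = (ι l , ι r)

  allB : ∀ {n} → (Fin n → Bool) → Bool
  allB {zero} f = true
  allB {suc n} f = f zero ∧ allB (f ∘ suc)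

  sumF : ∀ {n} → (Fin n → ℕ) → ℕ
  sumF {zero} f = 0
  sumF {suc n} f = f zero + sumF (f ∘ suc)

  maxAll : ∀ {n} → (Fin n → Ext) → Ext → Ext
  maxAll {zero} f e = e
  maxAll {suc n} f e = maxAll (f ∘ suc) (maxE e (f zero))

  upd : ∀ {n} {X : Set} → Fin n → X → (Fin n → X) → Fin n → X
  upd i x f j = if does (i Fin.≟ j) then x else f j

  record State (m : ℕ) : Set where
    field
      rest : Fin m → List Iv   -- unread part of each input list
      cur  : Fin m → Iv
      inQ  : Fin m → Bool      -- membership of indices in Q
      rQ   : Ext
      c    : EIv
  open State public

  -- a selector returning a top index of a full queue: an index whose
  -- current interval is ⪯-least
  Sel : ℕ → Set
  Sel m = (Fin m → Iv) → Fin m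

  TopSpec : ∀ {m} → Sel m → Set
  TopSpec {m} sel = ∀ (cur : Fin m → Iv) (j : Fin m) → cur (sel cur) ⪯ cur j

  initState : ∀ {m} → (Fin m → List⁺ Iv) → State m
  initState A = record
    { rest = tail ∘ A
    ; cur  = head ∘ A
    ; inQ  = λ _ → true
    ; rQ   = maxAll (λ i → ι (proj₂ (head (A i)))) -∞
    ; c    = (-∞ , -∞)
    }

  module Algo {m : ℕ} (sel : Sel m) where

    top : State m → Fin m
    top s = sel (cur s)

    topIv : State m → EIv
    topIv s = liftIv (cur s (top s))

    full : State m → Bool
    full s = allB (inQ s)

    span : State m → EIv
    span s = (proj₁ (topIv s) , rQ s)

    advanceWith : (s : State m) → List Iv → State m
    advanceWith s [] = record s { inQ = upd (top s) false (inQ s) }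
    advanceWith s (x ∷ xs) = record s
      { rest = upd (top s) xs (rest s)
      ; cur  = upd (top s) x (cur s)
      ; rQ   = maxE (rQ s) (ι (proj₂ x))
      }

    advance : State m → State m
    advance s = advanceWith s (rest s (top s))

    -- number of advance steps still possible (used as fuel; it bounds
    -- the number of iterations of every loop)
    measure : State m → ℕ
    measure s = sumF (λ i → length (rest s i) + (if inQ s i then 1 else 0))

    loop1 : ℕ → State m → State m
    loop1 zero s = s
    loop1 (suc f) s = if full s ∧ (c s ⊆ᵇ span s) then loop1 f (advance s) else s

    loop2 : ℕ → State m → Maybe EIv × State m
    loop2 f s = body (record s { c = span s })
      where
      afterAdvance : ℕ → State m → Maybe EIv × State m
      afterAdvance zero s2 = (just (c s2) , s2)
      afterAdvance (suc f') s2 =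
        if full s2 ∧ (span s2 ⊆ᵇ c s2) then loop2 f' s2 else (just (c s2) , s2)
      body : State m → Maybe EIv × State m
      body s1 = if c s1 ==ᵇ topIv s1 then (just (c s1) , s1)
                else afterAdvance f (advance s1)

    next : State m → Maybe EIv × State m
    next s = if full s' then loop2 fuel s' else (nothing , s')
      where
      fuel = suc (measure s)
      s' = loop1 fuel s

    calls : ℕ → State m → List (Maybe EIv)
    calls zero s = []
    calls (suc k) s = proj₁ (next s) ∷ calls k (proj₂ (next s))

-- Let τ k be the state after k advances and σ k = [L k .. R k] its span. Since advance never reads c,
-- every state the algorithm reaches is some τ k with c overwritten. Both extremes of σ k are
-- nondecreasing in k, σ k is spanned by the current intervals, and every spanned interval J contains
-- some σ k taken while Q is full: advancing the top index never discards a member of a tuple spanning J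
-- unless the current span already lies inside J. Hence AND is the set of inclusion-minimal full spans.
-- A call to next first skips the spans containing the previous output, then follows spans that keep
-- their right extreme, and returns the last one. Its left extreme exceeds those of all earlier spans and
-- its right extreme is below those of all later ones, so it is minimal; a minimal span passed over on
-- the way contains, hence equals, the previous output or this one.

module Submission where

open import Defs
open import Data.Nat using (ℕ; zero; suc; _+_; _*_; z≤n; s≤s)
  renaming (_≤_ to _≤ℕ_; _<_ to _<ℕ_)
open import Data.Nat.Properties as ℕ using ()
open import Data.Bool using (Bool; true; false; _∧_; if_then_else_)
open import Data.Bool.Properties using (∧-conicalˡ; ∧-conicalʳ)
open import Data.Fin using (Fin; zero; suc)
import Data.Fin as Fin
open import Data.List using (List; []; _∷_; _++_; map; length)
open import Data.List.NonEmpty using (List⁺; toList; head)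
open import Data.List.Relation.Unary.All as All using (All; []; _∷_)
open import Data.List.Relation.Unary.Any using (here; there)
open import Data.List.Relation.Unary.AllPairs using ([]; _∷_)
open import Data.List.Relation.Unary.Unique.Propositional using (Unique)
open import Data.List.Membership.Propositional using (_∈_)
open import Data.Maybe using (Maybe; just; nothing)
open import Data.Product using (_×_; Σ; _,_; proj₁; proj₂)
open import Data.Sum using (_⊎_; inj₁; inj₂)
open import Data.Empty using (⊥-elim)
open import Data.Unit using (⊤; tt)
open import Function using (_∘_; id)
open import Level using (Level)
open import Relation.Nullary using (¬_; yes; no)
open import Relation.Binary.Core using (Rel)
open import Relation.Binary.Definitions using (Reflexive; Transitive; tri<; tri≈; tri>)
open import Relation.Binary.PropositionalEquality
  using (_≡_; _≢_; refl; sym; trans; cong; cong₂; subst; subst₂)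
open import Relation.Binary.Structures using (IsStrictTotalOrder; IsTotalOrder)
import Relation.Binary.Construct.StrictToNonStrict as StrictToNonStrict

module _ {b ℓ : Level} {B : Set b} (_∼_ : Rel B ℓ) (∼-refl : Reflexive _∼_) (∼-trans : Transitive _∼_)
         (f : ℕ → B) where

  steps⇒chain : ∀ {j k} → j ≤ℕ k → (∀ q → j ≤ℕ q → q <ℕ k → f q ∼ f (suc q)) → f j ∼ f k
  steps⇒chain {j} {k} j≤k step with ℕ.m≤n⇒m<n∨m≡n j≤k
  ... | inj₂ refl = ∼-refl
  ... | inj₁ (s≤s {n = k′} j≤k′) =
    ∼-trans (steps⇒chain j≤k′ λ q j≤q q<k′ → step q j≤q (ℕ.m≤n⇒m≤1+n q<k′)) (step k′ j≤k′ ℕ.≤-refl)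

  steps⇒mono : (∀ q → f q ∼ f (suc q)) → ∀ {j k} → j ≤ℕ k → f j ∼ f k
  steps⇒mono step j≤k = steps⇒chain j≤k (λ q _ _ → step q)

if-true : ∀ {X : Set} {b} {x y : X} → b ≡ true → (if b then x else y) ≡ x
if-true refl = refl

if-false : ∀ {X : Set} {b} {x y : X} → b ≡ false → (if b then x else y) ≡ y
if-false refl = refl

∧-falseʳ : ∀ {a b} → a ≡ true → a ∧ b ≡ false → b ≡ false
∧-falseʳ refl b≡false = b≡false

true≢false : true ≢ false
true≢false ()

module _ {O : Set} {_<_ : O → O → Set} (sto : IsStrictTotalOrder _≡_ _<_) where
  open AND sto
  open IsStrictTotalOrder sto using (compare; _<?_; <-respʳ-≈; <-respˡ-≈)
    renaming (trans to <-trans; irrefl to <-irrefl)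
  open IsTotalOrder (StrictToNonStrict.isTotalOrder _≡_ _<_ sto)
    using () renaming (refl to ≤-refl; trans to ≤-trans; antisym to ≤-antisym)

  <-≤-trans : ∀ {a b c} → a < b → b ≤ c → a < c
  <-≤-trans = StrictToNonStrict.<-≤-trans _≡_ _<_ <-trans <-respʳ-≈

  ≤-<-trans : ∀ {a b c} → a ≤ b → b < c → a < c
  ≤-<-trans = StrictToNonStrict.≤-<-trans _≡_ _<_ sym <-trans <-respˡ-≈

  <⇒≱ : ∀ {a b} → a < b → ¬ (b ≤ a)
  <⇒≱ a<b b≤a = <-irrefl refl (<-≤-trans a<b b≤a)

  ≰⇒> : ∀ {a b} → ¬ (a ≤ b) → b < a
  ≰⇒> {a} {b} a≰b with compare a b
  ... | tri< a<b _ _ = ⊥-elim (a≰b (inj₁ a<b))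
  ... | tri≈ _ a≡b _ = ⊥-elim (a≰b (inj₂ a≡b))
  ... | tri> _ _ b<a = b<a

  ≮⇒≥ : ∀ {a b} → ¬ (a < b) → b ≤ a
  ≮⇒≥ {a} {b} a≮b with compare a b
  ... | tri< a<b _ _ = ⊥-elim (a≮b a<b)
  ... | tri≈ _ a≡b _ = inj₂ (sym a≡b)
  ... | tri> _ _ b<a = inj₁ b<a

  ⊆-refl : ∀ {I} → I ⊆ I
  ⊆-refl = ≤-refl , ≤-refl

  ⊆-trans : ∀ {I J K} → I ⊆ J → J ⊆ K → I ⊆ K
  ⊆-trans (l₁ , r₁) (l₂ , r₂) = ≤-trans l₂ l₁ , ≤-trans r₁ r₂

  ⊆-antisym : ∀ {I J} → I ⊆ J → J ⊆ I → I ≡ J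
  ⊆-antisym (l₁ , r₁) (l₂ , r₂) = cong₂ _,_ (≤-antisym l₂ l₁) (≤-antisym r₁ r₂)

  ≤ᵉ-sound : ∀ {a b} → (ι a ≤ᵉ ι b) ≡ true → a ≤ b
  ≤ᵉ-sound {a} {b} e with b <? a
  ... | no b≮a = ≮⇒≥ b≮a

  ≤ᵉ-complete : ∀ {a b} → a ≤ b → (ι a ≤ᵉ ι b) ≡ true
  ≤ᵉ-complete {a} {b} a≤b with b <? a
  ... | yes b<a = ⊥-elim (<⇒≱ b<a a≤b)
  ... | no _ = refl

  ⊆ᵇ-sound : ∀ {I J} → (liftIv I ⊆ᵇ liftIv J) ≡ true → I ⊆ J
  ⊆ᵇ-sound {l , r} {l′ , r′} e =
    ≤ᵉ-sound (∧-conicalˡ (ι l′ ≤ᵉ ι l) _ e) , ≤ᵉ-sound (∧-conicalʳ (ι l′ ≤ᵉ ι l) _ e)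

  ⊆ᵇ-complete : ∀ {I J} → I ⊆ J → (liftIv I ⊆ᵇ liftIv J) ≡ true
  ⊆ᵇ-complete (l′≤l , r≤r′) rewrite ≤ᵉ-complete l′≤l | ≤ᵉ-complete r≤r′ = refl

  ≡ᵉ-sound : ∀ {a b} → (ι a ≡ᵉ ι b) ≡ true → a ≡ b
  ≡ᵉ-sound {a} {b} e =
    ≤-antisym (≤ᵉ-sound (∧-conicalˡ (ι a ≤ᵉ ι b) _ e)) (≤ᵉ-sound (∧-conicalʳ (ι a ≤ᵉ ι b) _ e))

  ==ᵇ-sound : ∀ {I J} → (liftIv I ==ᵇ liftIv J) ≡ true → I ≡ J
  ==ᵇ-sound {l , r} {l′ , r′} e =
    cong₂ _,_ (≡ᵉ-sound (∧-conicalˡ (ι l ≡ᵉ ι l′) _ e)) (≡ᵉ-sound (∧-conicalʳ (ι l ≡ᵉ ι l′) _ e))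

  infixl 30 _⊔_
  _⊔_ : O → O → O
  a ⊔ b = if b <ᵇ a then a else b

  maxE-ι : ∀ a b → maxE (ι a) (ι b) ≡ ι (a ⊔ b)
  maxE-ι a b with b <? a
  ... | yes _ = refl
  ... | no _ = refl

  ⊔-upper : ∀ a b → (a ≤ a ⊔ b) × (b ≤ a ⊔ b)
  ⊔-upper a b with b <? a
  ... | yes b<a = ≤-refl , inj₁ b<a
  ... | no b≮a = ≮⇒≥ b≮a , ≤-refl

  ⊔-sel : ∀ a b → (a ⊔ b ≡ a) ⊎ (a ⊔ b ≡ b)
  ⊔-sel a b with b <? a
  ... | yes _ = inj₁ refl
  ... | no _ = inj₂ refl

  record IsMax {k : ℕ} (g : Fin k → O) (R : O) : Set where
    field
      upper    : ∀ i → g i ≤ R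
      attained : Σ (Fin k) λ j → g j ≡ R

  ⊔-head : ∀ {k} → (Fin (suc (suc k)) → O) → Fin (suc k) → O
  ⊔-head g zero = g zero ⊔ g (suc zero)
  ⊔-head g (suc i) = g (suc (suc i))

  maxAll-ι : ∀ {k} (g : Fin (suc k) → O) →
    Σ O λ R → (maxAll (ι ∘ g ∘ suc) (ι (g zero)) ≡ ι R) × IsMax g R
  maxAll-ι {zero} g = g zero , refl , record { upper = λ { zero → ≤-refl } ; attained = zero , refl }
  maxAll-ι {suc k} g with maxAll-ι (⊔-head g)
  ... | R , e , isMax =
    R , trans (cong (maxAll (ι ∘ ⊔-head g ∘ suc)) (maxE-ι (g zero) (g (suc zero)))) e , record
    { upper = λ { zero → ≤-trans (proj₁ (⊔-upper _ _)) (upper zero)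
                ; (suc zero) → ≤-trans (proj₂ (⊔-upper _ _)) (upper zero)
                ; (suc (suc i)) → upper (suc i) }
    ; attained = attained′ attained }
    where
    open IsMax isMax
    attained′ : Σ (Fin (suc k)) (λ j → ⊔-head g j ≡ R) → Σ (Fin (suc (suc k))) λ j → g j ≡ R
    attained′ (zero , e₀) with ⊔-sel (g zero) (g (suc zero))
    ... | inj₁ e₁ = zero , trans (sym e₁) e₀
    ... | inj₂ e₁ = suc zero , trans (sym e₁) e₀
    attained′ (suc j , eⱼ) = suc (suc j) , eⱼ

  upd-self : ∀ {k} {X : Set} (i : Fin k) (x : X) f → upd i x f i ≡ x
  upd-self i x f with i Fin.≟ i
  ... | yes _ = refl
  ... | no i≢i = ⊥-elim (i≢i refl)

  upd-other : ∀ {k} {X : Set} {i j : Fin k} (x : X) f → i ≢ j → upd i x f j ≡ f j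
  upd-other {i = i} {j} x f i≢j with i Fin.≟ j
  ... | yes i≡j = ⊥-elim (i≢j i≡j)
  ... | no _ = refl

  upd-elim : ∀ {k} {X : Set} (P : Fin k → X → Set) {i x f} →
    P i x → (∀ j → i ≢ j → P j (f j)) → ∀ j → P j (upd i x f j)
  upd-elim P {i} px pf j with i Fin.≟ j
  ... | yes refl = px
  ... | no i≢j = pf j i≢j

  upd₂-elim : ∀ {k} {X Y : Set} (P : Fin k → X → Y → Set) {i x y f g} →
    P i x y → (∀ j → i ≢ j → P j (f j) (g j)) → ∀ j → P j (upd i x f j) (upd i y g j)
  upd₂-elim P {i} pxy pfg j with i Fin.≟ j
  ... | yes refl = pxy
  ... | no i≢j = pfg j i≢j

  allB-true⁻ : ∀ {k} (f : Fin k → Bool) → allB f ≡ true → ∀ i → f i ≡ true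
  allB-true⁻ f e zero = ∧-conicalˡ (f zero) _ e
  allB-true⁻ f e (suc i) = allB-true⁻ (f ∘ suc) (∧-conicalʳ (f zero) _ e) i

  allB-true⁺ : ∀ {k} (f : Fin k → Bool) → (∀ i → f i ≡ true) → allB f ≡ true
  allB-true⁺ {zero} f _ = refl
  allB-true⁺ {suc k} f h rewrite h zero = allB-true⁺ (f ∘ suc) (h ∘ suc)

  sumF-mono : ∀ {k} {f g : Fin k → ℕ} → (∀ i → f i ≤ℕ g i) → sumF f ≤ℕ sumF g
  sumF-mono {zero} _ = z≤n
  sumF-mono {suc k} f≤g = ℕ.+-mono-≤ (f≤g zero) (sumF-mono (f≤g ∘ suc))

  sumF-mono-< : ∀ {k} {f g : Fin k → ℕ} → (∀ i → f i ≤ℕ g i) → ∀ j → f j <ℕ g j → sumF f <ℕ sumF g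
  sumF-mono-< f≤g zero fj<gj = ℕ.+-mono-<-≤ fj<gj (sumF-mono (f≤g ∘ suc))
  sumF-mono-< f≤g (suc j) fj<gj = ℕ.+-mono-≤-< (f≤g zero) (sumF-mono-< (f≤g ∘ suc) j fj<gj)

  left right : Iv → O
  left = proj₁
  right = proj₂

  _≺_ : Iv → Iv → Set
  I ≺ J = left I < left J × right I < right J

  antichain-head-≺ : ∀ {I Is J} → NatAntichain (I ∷ Is) → J ∈ Is → I ≺ J
  antichain-head-≺ (I-Is ∷ _) J∈Is with All.lookup I-Is J∈Is
  ... | _ , J⊈I , l<l′ = l<l′ , ≰⇒> (λ r′≤r → J⊈I (inj₁ l<l′ , r′≤r))

  antichain-head-right-≤ : ∀ {I Is J} → NatAntichain (I ∷ Is) → J ∈ I ∷ Is → right I ≤ right J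
  antichain-head-right-≤ _ (here refl) = ≤-refl
  antichain-head-right-≤ ac (there J∈Is) = inj₁ (proj₂ (antichain-head-≺ ac J∈Is))

  module Run (n : ℕ) (A : Fin (suc n) → List⁺ Iv) (A-antichain : ∀ i → NatAntichain (toList (A i)))
             (sel : Sel (suc n)) (sel-top : TopSpec sel) where
    open Algo sel

    St : Set
    St = State (suc n)

    unread : St → Fin (suc n) → List Iv
    unread s i = cur s i ∷ rest s i

    record Invariant (s : St) : Set where
      field
        antichain  : ∀ i → NatAntichain (unread s i)
        fromInput  : ∀ i → All (_∈ toList (A i)) (unread s i)
        rightQ     : O
        rQ≡        : rQ s ≡ ι rightQ
        rightQ-max : IsMax (right ∘ cur s) rightQ

    invariant-init : Invariant (initState A)
    invariant-init with maxAll-ι (λ i → right (head (A i)))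
    ... | R , e , isMax = record
      { antichain = A-antichain ; fromInput = λ i → All.tabulate id
      ; rightQ = R ; rQ≡ = e ; rightQ-max = isMax }

    top≺next : ∀ s {I Is} → rest s (top s) ≡ I ∷ Is → Invariant s → cur s (top s) ≺ I
    top≺next s e inv = antichain-head-≺
      (subst (λ l → NatAntichain (cur s (top s) ∷ l)) e (Invariant.antichain inv (top s))) (here refl)

    invariant-advanceWith : ∀ s l → rest s (top s) ≡ l → Invariant s → Invariant (advanceWith s l)
    invariant-advanceWith s [] _ inv = record { Invariant inv }
    invariant-advanceWith s (I ∷ Is) e inv = record
      { antichain = upd₂-elim (λ i J Js → NatAntichain (J ∷ Js)) {t} ac-t (λ j _ → antichain j)
      ; fromInput = upd₂-elim (λ i J Js → All (_∈ toList (A i)) (J ∷ Js)) {t} in-t (λ j _ → fromInput j)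
      ; rightQ = rightQ ⊔ right I
      ; rQ≡ = trans (cong (λ z → maxE z (ι (right I))) rQ≡) (maxE-ι rightQ (right I))
      ; rightQ-max = record
        { upper = upd-elim (λ _ J → right J ≤ rightQ ⊔ right I) {t} (proj₂ (⊔-upper _ _))
                    (λ j _ → ≤-trans (upper j) (proj₁ (⊔-upper _ _)))
        ; attained = attained′ (⊔-sel rightQ (right I)) } }
      where
      open Invariant inv
      open IsMax rightQ-max
      t : Fin (suc n)
      t = top s
      ac-t : NatAntichain (I ∷ Is)
      ac-t with subst (λ l → NatAntichain (cur s t ∷ l)) e (antichain t)
      ... | _ ∷ ac = ac
      in-t : All (_∈ toList (A t)) (I ∷ Is)
      in-t with subst (λ l → All (_∈ toList (A t)) (cur s t ∷ l)) e (fromInput t)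
      ... | _ ∷ in-Is = in-Is
      attained′ : (rightQ ⊔ right I ≡ rightQ) ⊎ (rightQ ⊔ right I ≡ right I) →
        Σ (Fin (suc n)) λ j → right (upd t I (cur s) j) ≡ rightQ ⊔ right I
      attained′ (inj₂ e′) = t , trans (cong right (upd-self t I (cur s))) (sym e′)
      attained′ (inj₁ e′) with t Fin.≟ proj₁ attained
      ... | no t≢j =
        proj₁ attained , trans (cong right (upd-other I (cur s) t≢j)) (trans (proj₂ attained) (sym e′))
      ... | yes refl = ⊥-elim (<⇒≱ (subst (_< right I) (proj₂ attained) (proj₂ (top≺next s e inv)))
                                    (subst (right I ≤_) e′ (proj₂ (⊔-upper rightQ (right I)))))

    top-left-≤ : ∀ (s : St) j → left (cur s (top s)) ≤ left (cur s j)
    top-left-≤ s j with sel-top (cur s) j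
    ... | inj₁ l<l′ = inj₁ l<l′
    ... | inj₂ (l≡l′ , _) = inj₂ l≡l′

    cur-advanceWith-≤ : ∀ s l → rest s (top s) ≡ l → Invariant s → ∀ j →
      left (cur s j) ≤ left (cur (advanceWith s l) j) × right (cur s j) ≤ right (cur (advanceWith s l) j)
    cur-advanceWith-≤ s [] _ _ j = ≤-refl , ≤-refl
    cur-advanceWith-≤ s (I ∷ Is) e inv =
      upd-elim (λ j J → left (cur s j) ≤ left J × right (cur s j) ≤ right J) {top s}
        (inj₁ (proj₁ (top≺next s e inv)) , inj₁ (proj₂ (top≺next s e inv))) (λ _ _ → ≤-refl , ≤-refl)

    advanceWith-[]-not-full : ∀ (s : St) → full (advanceWith s []) ≢ true
    advanceWith-[]-not-full s e = true≢false
      (trans (sym (allB-true⁻ (upd (top s) false (inQ s)) e (top s))) (upd-self (top s) false (inQ s)))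

    full-advanceWith⁻ : ∀ (s : St) l → full (advanceWith s l) ≡ true → full s ≡ true
    full-advanceWith⁻ s [] e = ⊥-elim (advanceWith-[]-not-full s e)
    full-advanceWith⁻ s (_ ∷ _) e = e

    weight : St → Fin (suc n) → ℕ
    weight s i = length (rest s i) + (if inQ s i then 1 else 0)

    weight-advanceWith-≤ : ∀ s l → rest s (top s) ≡ l → ∀ i → weight (advanceWith s l) i ≤ℕ weight s i
    weight-advanceWith-≤ s [] _ =
      upd-elim (λ i b → length (rest s i) + (if b then 1 else 0) ≤ℕ weight s i) {top s}
        (ℕ.+-monoʳ-≤ (length (rest s (top s))) z≤n) (λ _ _ → ℕ.≤-refl)
    weight-advanceWith-≤ s (I ∷ Is) e =
      upd-elim (λ i Js → length Js + (if inQ s i then 1 else 0) ≤ℕ weight s i) {top s}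
        (subst (λ l → length Is + inQ-t ≤ℕ length l + inQ-t) (sym e) (ℕ.+-monoˡ-≤ inQ-t (ℕ.n≤1+n _)))
        (λ _ _ → ℕ.≤-refl)
      where
      inQ-t : ℕ
      inQ-t = if inQ s (top s) then 1 else 0

    weight-advanceWith-top-< : ∀ s l → rest s (top s) ≡ l → inQ s (top s) ≡ true →
      weight (advanceWith s l) (top s) <ℕ weight s (top s)
    weight-advanceWith-top-< s [] _ inQ-t rewrite upd-self (top s) false (inQ s) | inQ-t =
      ℕ.+-monoʳ-< (length (rest s (top s))) ℕ.0<1+n
    weight-advanceWith-top-< s (I ∷ Is) e _ rewrite upd-self (top s) Is (rest s) | e =
      ℕ.+-monoˡ-< _ (ℕ.n<1+n (length Is))

    measure-advance-≤ : ∀ (s : St) → measure (advance s) ≤ℕ measure s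
    measure-advance-≤ s = sumF-mono (weight-advanceWith-≤ s (rest s (top s)) refl)

    measure-advance-< : ∀ (s : St) → full s ≡ true → measure (advance s) <ℕ measure s
    measure-advance-< s full-s = sumF-mono-< (weight-advanceWith-≤ s (rest s (top s)) refl) (top s)
      (weight-advanceWith-top-< s (rest s (top s)) refl (allB-true⁻ (inQ s) full-s (top s)))

    measure-pos : ∀ (s : St) → full s ≡ true → 0 <ℕ measure s
    measure-pos s full-s = ℕ.≤-<-trans z≤n (measure-advance-< s full-s)

    τ : ℕ → St
    τ zero = initState A
    τ (suc k) = advance (τ k)

    invariant : ∀ k → Invariant (τ k)
    invariant zero = invariant-init
    invariant (suc k) = invariant-advanceWith (τ k) (rest (τ k) (top (τ k))) refl (invariant k)

    Full : ℕ → Set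
    Full k = full (τ k) ≡ true

    L R : ℕ → O
    L k = left (cur (τ k) (top (τ k)))
    R k = Invariant.rightQ (invariant k)

    σ : ℕ → Iv
    σ k = L k , R k

    span-τ : ∀ k → span (τ k) ≡ liftIv (σ k)
    span-τ k = cong (ι (L k) ,_) (Invariant.rQ≡ (invariant k))

    Full-0 : Full 0
    Full-0 = allB-true⁺ {suc n} (λ _ → true) (λ _ → refl)

    Full-step : ∀ k → Full (suc k) → Full k
    Full-step k = full-advanceWith⁻ (τ k) (rest (τ k) (top (τ k)))

    Full-anti : ∀ {j k} → j ≤ℕ k → Full k → Full j
    Full-anti = steps⇒mono (λ P Q → Q → P) (λ p → p) (λ f g → f ∘ g) Full Full-step

    cur-step-≤ : ∀ k j →
      left (cur (τ k) j) ≤ left (cur (τ (suc k)) j) × right (cur (τ k) j) ≤ right (cur (τ (suc k)) j)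
    cur-step-≤ k = cur-advanceWith-≤ (τ k) (rest (τ k) (top (τ k))) refl (invariant k)

    L-mono : ∀ {j k} → j ≤ℕ k → L j ≤ L k
    L-mono = steps⇒mono _≤_ ≤-refl ≤-trans L λ k →
      ≤-trans (top-left-≤ (τ k) (top (τ (suc k)))) (proj₁ (cur-step-≤ k (top (τ (suc k)))))

    R-mono : ∀ {j k} → j ≤ℕ k → R j ≤ R k
    R-mono = steps⇒mono _≤_ ≤-refl ≤-trans R λ k →
      let open IsMax (Invariant.rightQ-max (invariant k)) using (attained)
          open IsMax (Invariant.rightQ-max (invariant (suc k))) using (upper)
          (j , e) = attained
      in subst (_≤ R (suc k)) e (≤-trans (proj₂ (cur-step-≤ k j)) (upper j))

    measure-anti : ∀ {j k} → j ≤ℕ k → measure (τ k) ≤ℕ measure (τ j)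
    measure-anti = steps⇒mono (λ a b → b ≤ℕ a) ℕ.≤-refl (λ p q → ℕ.≤-trans q p) (measure ∘ τ)
      (measure-advance-≤ ∘ τ)

    full-advanceWith⁺ : ∀ (s : St) {l J} → full s ≡ true → J ∈ l → full (advanceWith s l) ≡ true
    full-advanceWith⁺ s {_ ∷ _} full-s _ = full-s

    unread-advanceWith : ∀ (s : St) l → rest s (top s) ≡ l → ∀ {u : Fin (suc n) → Iv} →
      (∀ i → u i ∈ unread s i) → u (top s) ∈ l → ∀ i → u i ∈ unread (advanceWith s l) i
    unread-advanceWith s (I ∷ Is) _ {u} u∈ u-t∈ =
      upd₂-elim (λ i J Js → u i ∈ J ∷ Js) {top s} u-t∈ (λ j _ → u∈ j)

    advanceWith-top-right-> : ∀ (s : St) l → rest s (top s) ≡ l → Invariant s →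
      full (advanceWith s l) ≡ true → right (cur s (top s)) < right (cur (advanceWith s l) (top s))
    advanceWith-top-right-> s [] _ _ full-s′ = ⊥-elim (advanceWith-[]-not-full s full-s′)
    advanceWith-top-right-> s (I ∷ Is) e inv _ rewrite upd-self (top s) I (cur s) = proj₂ (top≺next s e inv)

    σ-spanned : ∀ k → Spanned A (σ k)
    σ-spanned k = cur (τ k) , (λ i → All.head (fromInput i)) ,
      (λ i → top-left-≤ (τ k) i , upper i) ,
      (λ J cur⊆J → proj₁ (cur⊆J (top (τ k))) ,
                   subst (_≤ right J) (proj₂ attained) (proj₂ (cur⊆J (proj₁ attained))))
      where
      open Invariant (invariant k)
      open IsMax rightQ-max

    σ-below-from : ∀ bound k {J} {u : Fin (suc n) → Iv} → (∀ i → u i ⊆ J) → measure (τ k) ≤ℕ bound → Full k →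
      (∀ i → u i ∈ unread (τ k) i) → Σ ℕ λ k′ → Full k′ × σ k′ ⊆ J
    σ-below-from zero k _ m≤0 full-k _ = ⊥-elim (ℕ.<⇒≱ (measure-pos (τ k) full-k) m≤0)
    σ-below-from (suc bound) k {J} {u} u⊆J m≤ full-k u∈ with u∈ (top (τ k))
    ... | here u-t≡cur = k , full-k , subst (λ I → left J ≤ left I) u-t≡cur (proj₁ (u⊆J (top (τ k)))) ,
      subst (_≤ right J) e (≤-trans (antichain-head-right-≤ (antichain j) (u∈ j)) (proj₂ (u⊆J j)))
      where
      open Invariant (invariant k)
      j : Fin (suc n)
      j = proj₁ (IsMax.attained rightQ-max)
      e : right (cur (τ k) j) ≡ R k
      e = proj₂ (IsMax.attained rightQ-max)
    ... | there u-t∈rest = σ-below-from bound (suc k) u⊆J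
      (ℕ.≤-pred (ℕ.≤-trans (measure-advance-< (τ k) full-k) m≤))
      (full-advanceWith⁺ (τ k) full-k u-t∈rest)
      (unread-advanceWith (τ k) (rest (τ k) (top (τ k))) refl u∈ u-t∈rest)

    σ-below : ∀ {J} → Spanned A J → Σ ℕ λ k → Full k × σ k ⊆ J
    σ-below (_ , u∈A , u⊆J , _) = σ-below-from (measure (τ 0)) 0 u⊆J ℕ.≤-refl Full-0 u∈A

    Minimal : Iv → Set
    Minimal X = ∀ j → Full j → σ j ⊆ X → σ j ≡ X

    MinimalSpan : Iv → Set
    MinimalSpan X = Σ ℕ λ k → Full k × σ k ≡ X × Minimal X

    MinimalSpan⇒InAND : ∀ {X} → MinimalSpan X → InAND A X
    MinimalSpan⇒InAND (k , _ , refl , minimal) = σ-spanned k , λ J J-spanned J⊆σk →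
      let (j , full-j , σj⊆J) = σ-below J-spanned
      in ⊆-antisym J⊆σk (subst (_⊆ J) (minimal j full-j (⊆-trans σj⊆J J⊆σk)) σj⊆J)

    InAND⇒MinimalSpan : ∀ {X} → InAND A X → MinimalSpan X
    InAND⇒MinimalSpan (X-spanned , minimal) with σ-below X-spanned
    ... | k , full-k , σk⊆X =
      k , full-k , minimal (σ k) (σ-spanned k) σk⊆X , λ j _ σj⊆X → minimal (σ j) (σ-spanned j) σj⊆X

    at : EIv → ℕ → St
    at x p = record (τ p) { c = x }

    advance-at : ∀ x p → advance (at x p) ≡ at x (suc p)
    advance-at x p = advanceWith-c (rest (τ p) (top (τ p)))
      where
      advanceWith-c : ∀ l → advanceWith (at x p) l ≡ record (advanceWith (τ p) l) { c = x }
      advanceWith-c [] = refl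
      advanceWith-c (_ ∷ _) = refl

    Skip : EIv → ℕ → Bool
    Skip x q = full (τ q) ∧ (x ⊆ᵇ span (τ q))

    record Loop1Exit (f : ℕ) (x : EIv) (p : ℕ) : Set where
      field
        exit    : ℕ
        loop1≡  : loop1 f (at x p) ≡ at x exit
        p≤exit  : p ≤ℕ exit
        skipped : ∀ q → p ≤ℕ q → q <ℕ exit → Skip x q ≡ true
        stopped : Skip x exit ≡ false

    loop1-exit : ∀ f x p → measure (τ p) <ℕ f → Loop1Exit f x p
    loop1-exit (suc f) x p m< with Skip x p in skip
    ... | false = record
      { exit = p ; loop1≡ = if-false skip ; p≤exit = ℕ.≤-refl
      ; skipped = λ q p≤q q<p → ⊥-elim (ℕ.<⇒≱ q<p p≤q) ; stopped = skip }
    ... | true = record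
      { exit = exit
      ; loop1≡ = trans (if-true skip) (trans (cong (loop1 f) (advance-at x p)) loop1≡)
      ; p≤exit = ℕ.<⇒≤ p<exit
      ; skipped = skipped′
      ; stopped = stopped }
      where
      open Loop1Exit (loop1-exit f x (suc p)
        (ℕ.<-≤-trans (measure-advance-< (τ p) (∧-conicalˡ (full (τ p)) _ skip)) (ℕ.≤-pred m<)))
        renaming (p≤exit to p<exit)
      skipped′ : ∀ q → p ≤ℕ q → q <ℕ exit → Skip x q ≡ true
      skipped′ q p≤q q<exit with ℕ.m≤n⇒m<n∨m≡n p≤q
      ... | inj₁ p<q = skipped q p<q q<exit
      ... | inj₂ refl = skip

    σ-top-R-< : ∀ k → Full (suc k) → (span (τ k) ==ᵇ topIv (τ k)) ≡ true → R k < R (suc k)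
    σ-top-R-< k full-k+1 isTop = subst (_< R (suc k)) (cong right (sym σ≡top))
      (<-≤-trans (advanceWith-top-right-> (τ k) (rest (τ k) (top (τ k))) refl (invariant k) full-k+1)
                 (IsMax.upper (Invariant.rightQ-max (invariant (suc k))) (top (τ k))))
      where
      σ≡top : σ k ≡ cur (τ k) (top (τ k))
      σ≡top = ==ᵇ-sound (subst (λ I → (I ==ᵇ topIv (τ k)) ≡ true) (span-τ k) isTop)

    span-⊆ᵇ-sound : ∀ j k → (span (τ j) ⊆ᵇ span (τ k)) ≡ true → σ j ⊆ σ k
    span-⊆ᵇ-sound j k = ⊆ᵇ-sound ∘ subst₂ (λ I J → (I ⊆ᵇ J) ≡ true) (span-τ j) (span-τ k)

    span-⊆ᵇ-complete : ∀ j k → σ j ⊆ σ k → (span (τ j) ⊆ᵇ span (τ k)) ≡ true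
    span-⊆ᵇ-complete j k = subst₂ (λ I J → (I ⊆ᵇ J) ≡ true) (sym (span-τ j)) (sym (span-τ k)) ∘ ⊆ᵇ-complete

    Shrinks : ℕ → Bool
    Shrinks p = full (τ (suc p)) ∧ (span (τ (suc p)) ⊆ᵇ span (τ p))

    loop2-step : ∀ f x p → (span (τ p) ==ᵇ topIv (τ p)) ≡ false →
      loop2 (suc f) (at x p) ≡ (if Shrinks p then loop2 f (at (span (τ p)) (suc p))
                                else (just (span (τ p)) , at (span (τ p)) (suc p)))
    loop2-step f x p notTop = trans (if-false notTop) (cong afterAdvance (advance-at (span (τ p)) p))
      where
      afterAdvance : St → Maybe EIv × St
      afterAdvance s = if full s ∧ (span s ⊆ᵇ c s) then loop2 f s else (just (c s) , s)

    record Loop2Exit (f : ℕ) (x : EIv) (p : ℕ) : Set where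
      field
        output      : ℕ
        resume      : ℕ
        loop2≡      : loop2 f (at x p) ≡ (just (span (τ output)) , at (span (τ output)) resume)
        p≤output    : p ≤ℕ output
        full-output : Full output
        R-const     : ∀ q → p ≤ℕ q → q <ℕ output → R (suc q) ≡ R q
        resume≡     : resume ≡ output ⊎ resume ≡ suc output
        R-jumps     : Full (suc output) → R output < R (suc output)

    loop2-exit : ∀ f x p → Full p → measure (τ p) ≤ℕ f → Loop2Exit f x p
    loop2-exit f x p full-p m≤f with span (τ p) ==ᵇ topIv (τ p) in isTop
    ... | true = record
      { output = p ; resume = p ; loop2≡ = if-true isTop ; p≤output = ℕ.≤-refl ; full-output = full-p
      ; R-const = λ q p≤q q<p → ⊥-elim (ℕ.<⇒≱ q<p p≤q) ; resume≡ = inj₁ refl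
      ; R-jumps = λ full-p+1 → σ-top-R-< p full-p+1 isTop }
    loop2-exit zero x p full-p m≤0 | false = ⊥-elim (ℕ.<⇒≱ (measure-pos (τ p) full-p) m≤0)
    loop2-exit (suc f) x p full-p m≤f | false with Shrinks p in shrinks
    ... | false = record
      { output = p ; resume = suc p ; loop2≡ = trans (loop2-step f x p isTop) (if-false shrinks)
      ; p≤output = ℕ.≤-refl ; full-output = full-p
      ; R-const = λ q p≤q q<p → ⊥-elim (ℕ.<⇒≱ q<p p≤q) ; resume≡ = inj₂ refl
      ; R-jumps = λ full-p+1 → ≰⇒> λ R≤R → true≢false (trans
          (sym (span-⊆ᵇ-complete (suc p) p (L-mono (ℕ.n≤1+n p) , R≤R))) (∧-falseʳ full-p+1 shrinks)) }
    ... | true = record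
      { output = output ; resume = resume
      ; loop2≡ = trans (loop2-step f x p isTop) (trans (if-true shrinks) loop2≡)
      ; p≤output = ℕ.<⇒≤ p<output ; full-output = full-output
      ; R-const = R-const′ ; resume≡ = resume≡ ; R-jumps = R-jumps }
      where
      open Loop2Exit (loop2-exit f (span (τ p)) (suc p) (∧-conicalˡ (full (τ (suc p))) _ shrinks)
        (ℕ.≤-pred (ℕ.≤-trans (measure-advance-< (τ p) full-p) m≤f)))
        renaming (p≤output to p<output)
      R-const′ : ∀ q → p ≤ℕ q → q <ℕ output → R (suc q) ≡ R q
      R-const′ q p≤q q<output with ℕ.m≤n⇒m<n∨m≡n p≤q
      ... | inj₁ p<q = R-const q p<q q<output
      ... | inj₂ refl = ≤-antisym
        (proj₂ (span-⊆ᵇ-sound (suc p) p (∧-conicalʳ (full (τ (suc p))) _ shrinks))) (R-mono (ℕ.n≤1+n p))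

    LeftBelow : EIv → O → Set
    LeftBelow (ι l , _) a = l < a
    LeftBelow (-∞ , _) _ = ⊤
    LeftBelow (+∞ , _) _ = ⊤

    LeftBelow-≤ : ∀ x {a b} → LeftBelow x a → a ≤ b → LeftBelow x b
    LeftBelow-≤ (ι _ , _) l<a a≤b = <-≤-trans l<a a≤b
    LeftBelow-≤ (-∞ , _) _ _ = tt
    LeftBelow-≤ (+∞ , _) _ _ = tt

    between : ∀ {k p} → p ≡ k ⊎ p ≡ suc k → k ≤ℕ p × p ≤ℕ suc k
    between (inj₁ refl) = ℕ.≤-refl , ℕ.n≤1+n _
    between (inj₂ refl) = ℕ.n≤1+n _ , ℕ.≤-refl

    -- After returning span (τ k), the state is τ k itself or, if loop 2 advanced past it, τ (suc k).
    data CallState : EIv → ℕ → Set where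
      initial : CallState (-∞ , -∞) 0
      after   : ∀ k {p} → p ≡ k ⊎ p ≡ suc k → CallState (span (τ k)) p

    record Outputs (x : EIv) (p : ℕ) : Set where
      field
        outputs  : List Iv
        calls≡   : calls (suc (length outputs)) (at x p) ≡ map (just ∘ liftIv) outputs ++ (nothing ∷ [])
        unique   : Unique outputs
        minimal  : All MinimalSpan outputs
        complete : ∀ k → p ≤ℕ k → Full k → Minimal (σ k) → (x ⊆ᵇ span (τ k)) ≡ false → σ k ∈ outputs
        above    : All (LeftBelow x ∘ left) outputs

    calls-next : ∀ k (s : St) {r s′} → next s ≡ (r , s′) → calls (suc k) s ≡ r ∷ calls k s′
    calls-next k _ = cong (λ r → proj₁ r ∷ calls k (proj₂ r))

    bit : Bool → ℕ
    bit true = 0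
    bit false = 1

    -- A call to next that does not advance Q starts with c ⊈ span(Q) and ends with c = span(Q);
    -- the extra bit makes μ decrease in that case too.
    μ : EIv → ℕ → ℕ
    μ x p = 2 * measure (τ p) + bit (x ⊆ᵇ span (τ p))

    twice-< : ∀ {a b} c d → a <ℕ b → c ≤ℕ 1 → 2 * a + c <ℕ 2 * b + d
    twice-< {a} {b} c d a<b c≤1 = begin-strict
      2 * a + c ≤⟨ ℕ.+-monoʳ-≤ (2 * a) c≤1 ⟩
      2 * a + 1 <⟨ ℕ.+-monoʳ-< (2 * a) (ℕ.n<1+n 1) ⟩
      2 * a + 2 ≡⟨ ℕ.+-comm (2 * a) 2 ⟩
      2 + 2 * a ≡⟨ ℕ.*-suc 2 a ⟨
      2 * suc a ≤⟨ ℕ.*-monoʳ-≤ 2 a<b ⟩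
      2 * b     ≤⟨ ℕ.m≤m+n (2 * b) d ⟩
      2 * b + d ∎
      where open ℕ.≤-Reasoning

    bit≤1 : ∀ b → bit b ≤ℕ 1
    bit≤1 true = z≤n
    bit≤1 false = ℕ.≤-refl

    μ-advance : ∀ y q d → Full q → μ y (suc q) <ℕ 2 * measure (τ q) + d
    μ-advance y q d full-q = twice-< _ d (measure-advance-< (τ q) full-q) (bit≤1 _)

    μ-self : ∀ q → μ (span (τ q)) q ≡ 2 * measure (τ q) + 0
    μ-self q = cong (λ b → 2 * measure (τ q) + bit b) (span-⊆ᵇ-complete q q ⊆-refl)

    skipped-⊆ᵇ : ∀ {f x p} (ex : Loop1Exit f x p) →
      ∀ q → p ≤ℕ q → q <ℕ Loop1Exit.exit ex → (x ⊆ᵇ span (τ q)) ≡ true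
    skipped-⊆ᵇ ex q p≤q q<exit = ∧-conicalʳ (full (τ q)) _ (Loop1Exit.skipped ex q p≤q q<exit)

    left-gap : ∀ {f x p} → CallState x p → (ex : Loop1Exit f x p) → let open Loop1Exit ex in
      Full exit → (∀ j → j <ℕ exit → L j < L exit) × LeftBelow x (L exit)
    left-gap initial ex _ = (λ j j<exit → ⊥-elim (true≢false (sym (skipped-⊆ᵇ ex j z≤n j<exit)))) , tt
    left-gap {p = p} (after k p≡) ex full-exit = L-below , Lk<Lexit
      where
      open Loop1Exit ex
      k≤p : k ≤ℕ p
      k≤p = proj₁ (between p≡)
      Lk<Lexit : L k < L exit
      Lk<Lexit = ≰⇒> λ Lexit≤Lk → true≢false (trans
        (sym (span-⊆ᵇ-complete k exit (Lexit≤Lk , R-mono (ℕ.≤-trans k≤p p≤exit))))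
        (∧-falseʳ full-exit stopped))
      L-below : ∀ j → j <ℕ exit → L j < L exit
      L-below j j<exit with j ℕ.<? p
      ... | yes j<p = ≤-<-trans (L-mono (ℕ.≤-pred (ℕ.≤-trans j<p (proj₂ (between p≡))))) Lk<Lexit
      ... | no j≮p = ≤-<-trans (proj₁ (span-⊆ᵇ-sound k j (skipped-⊆ᵇ ex j (ℕ.≮⇒≥ j≮p) j<exit))) Lk<Lexit

    nextFuel : ℕ → ℕ
    nextFuel p = suc (measure (τ p))

    module Call {x : EIv} {p : ℕ} (cs : CallState x p) (loop1Exit : Loop1Exit (nextFuel p) x p) where
      open Loop1Exit loop1Exit public

      next≡ : next (at x p) ≡
        (if full (τ exit) then loop2 (nextFuel p) (at x exit) else (nothing , at x exit))
      next≡ = cong (λ s → if full s then loop2 (nextFuel p) s else (nothing , s)) loop1≡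

      passed : ∀ q → p ≤ℕ q → (x ⊆ᵇ span (τ q)) ≡ false → exit ≤ℕ q
      passed q p≤q x⊈ = ℕ.≮⇒≥ λ q<exit → true≢false (trans (sym (skipped-⊆ᵇ loop1Exit q p≤q q<exit)) x⊈)

      exhausted : full (τ exit) ≡ false → Outputs x p
      exhausted not-full = record
        { outputs = [] ; calls≡ = calls-next 0 (at x p) (trans next≡ (if-false not-full))
        ; unique = [] ; minimal = []
        ; complete = λ k p≤k full-k _ x⊈ →
            ⊥-elim (true≢false (trans (sym (Full-anti (passed k p≤k x⊈) full-k)) not-full))
        ; above = [] }

      module Found (full-exit : Full exit) (loop2Exit : Loop2Exit (nextFuel p) x exit) where
        open Loop2Exit loop2Exit public renaming (p≤output to exit≤output)

        open ℕ.≤-Reasoning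

        x⊆? : Bool
        x⊆? = x ⊆ᵇ span (τ p)

        p≤output : p ≤ℕ output
        p≤output = ℕ.≤-trans p≤exit exit≤output

        next≡just : next (at x p) ≡ (just (span (τ output)) , at (span (τ output)) resume)
        next≡just = trans next≡ (trans (if-true full-exit) loop2≡)

        R-flat : ∀ {j} → exit ≤ℕ j → j ≤ℕ output → R j ≡ R output
        R-flat exit≤j j≤out =
          steps⇒chain _≡_ refl trans R j≤out λ q j≤q q<out → sym (R-const q (ℕ.≤-trans exit≤j j≤q) q<out)

        output-minimal : Minimal (σ output)
        output-minimal j full-j (Lout≤Lj , Rj≤Rout) with j ℕ.<? exit
        ... | yes j<exit = ⊥-elim (<⇒≱
          (<-≤-trans (proj₁ (left-gap cs loop1Exit full-exit) j j<exit) (L-mono exit≤output)) Lout≤Lj)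
        ... | no j≮exit with j ℕ.≤? output
        ...   | yes j≤out = cong₂ _,_ (≤-antisym (L-mono j≤out) Lout≤Lj) (R-flat (ℕ.≮⇒≥ j≮exit) j≤out)
        ...   | no j≰out = ⊥-elim (<⇒≱
          (<-≤-trans (R-jumps (Full-anti (ℕ.≰⇒> j≰out) full-j)) (R-mono (ℕ.≰⇒> j≰out))) Rj≤Rout)

        output-above : LeftBelow x (L output)
        output-above = LeftBelow-≤ x (proj₂ (left-gap cs loop1Exit full-exit)) (L-mono exit≤output)

        resume≤ : ∀ {k} → output <ℕ k → resume ≤ℕ k
        resume≤ out<k = ℕ.≤-trans (proj₂ (between resume≡)) out<k

        μ-decreases : μ (span (τ output)) resume <ℕ μ x p
        μ-decreases with resume≡
        ... | inj₂ e = begin-strict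
          μ (span (τ output)) resume       ≡⟨ cong (μ (span (τ output))) e ⟩
          μ (span (τ output)) (suc output) <⟨ μ-advance (span (τ output)) output (bit x⊆?) full-output ⟩
          2 * measure (τ output) + bit x⊆? ≤⟨ ℕ.+-monoˡ-≤ (bit x⊆?) (ℕ.*-monoʳ-≤ 2 (measure-anti p≤output)) ⟩
          μ x p                            ∎
        ... | inj₁ e with ℕ.m≤n⇒m<n∨m≡n p≤exit
        ...   | inj₁ p<exit = begin-strict
          μ (span (τ output)) resume ≡⟨ trans (cong (μ (span (τ output))) e) (μ-self output) ⟩
          2 * measure (τ output) + 0 <⟨ twice-< 0 (bit x⊆?)
                                         (ℕ.≤-<-trans (measure-anti (ℕ.≤-trans p<exit exit≤output))
                                           (measure-advance-< (τ p) (Full-anti (ℕ.<⇒≤ p<exit) full-exit)))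
                                         z≤n ⟩
          μ x p                      ∎
        ...   | inj₂ p≡exit = begin-strict
          μ (span (τ output)) resume ≡⟨ trans (cong (μ (span (τ output))) e) (μ-self output) ⟩
          2 * measure (τ output) + 0 <⟨ ℕ.+-mono-≤-< (ℕ.*-monoʳ-≤ 2 (measure-anti p≤output)) (ℕ.n<1+n 0) ⟩
          2 * measure (τ p) + 1      ≡⟨ cong (λ b → 2 * measure (τ p) + bit b) x⊈p ⟨
          μ x p                      ∎
          where
          x⊈p : (x ⊆ᵇ span (τ p)) ≡ false
          x⊈p = ∧-falseʳ (subst Full (sym p≡exit) full-exit)
                         (subst (λ q → Skip x q ≡ false) (sym p≡exit) stopped)

        complete-step : ∀ {Ls : List Iv} →
          (∀ k → resume ≤ℕ k → Full k → Minimal (σ k) → (span (τ output) ⊆ᵇ span (τ k)) ≡ false → σ k ∈ Ls) →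
          ∀ k → p ≤ℕ k → Full k → Minimal (σ k) → (x ⊆ᵇ span (τ k)) ≡ false → σ k ∈ σ output ∷ Ls
        complete-step complete k p≤k full-k minimal-k x⊈ with k ℕ.≤? output
        ... | yes k≤out = here (sym (minimal-k output full-output
          (L-mono k≤out , inj₂ (sym (R-flat (passed k p≤k x⊈) k≤out)))))
        ... | no k≰out with span (τ output) ⊆ᵇ span (τ k) in out⊆k
        ...   | true = here (sym (minimal-k output full-output (span-⊆ᵇ-sound output k out⊆k)))
        ...   | false = there (complete k (resume≤ (ℕ.≰⇒> k≰out)) full-k minimal-k out⊆k)

        extend : Outputs (span (τ output)) resume → Outputs x p
        extend rest = record
          { outputs = σ output ∷ outputs
          ; calls≡ = trans (calls-next (suc (length outputs)) (at x p) next≡just)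
                           (cong₂ _∷_ (cong just (span-τ output)) calls≡)
          ; unique = All.map (λ Lout<l σ≡ → <-irrefl refl (subst (λ I → L output < left I) (sym σ≡) Lout<l))
                             above ∷ unique
          ; minimal = (output , full-output , refl , output-minimal) ∷ minimal
          ; complete = complete-step complete
          ; above = output-above ∷ All.map (λ Lout<l → LeftBelow-≤ x output-above (inj₁ Lout<l)) above }
          where open Outputs rest

    outputs-from : ∀ bound {x p} → μ x p <ℕ bound → CallState x p → Outputs x p
    outputs-from (suc bound) {x} {p} μ<bound cs = proceed
      where
      open Call cs (loop1-exit (nextFuel p) x p ℕ.≤-refl)
      proceed : Outputs x p
      proceed with full (τ exit) in full-exit
      ... | false = exhausted full-exit
      ... | true =
        extend (outputs-from bound (ℕ.<-≤-trans μ-decreases (ℕ.≤-pred μ<bound)) (after output resume≡))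
        where
        open Found full-exit
          (loop2-exit (nextFuel p) x exit full-exit (ℕ.≤-trans (measure-anti p≤exit) (ℕ.n≤1+n _)))

    enumerates-AND : Σ (List Iv) λ Is →
        (calls (suc (length Is)) (initState A) ≡ map (just ∘ liftIv) Is ++ (nothing ∷ []))
        × Unique Is
        × (∀ I → (I ∈ Is → InAND A I) × (InAND A I → I ∈ Is))
    enumerates-AND =
      outputs , calls≡ , unique , λ I → MinimalSpan⇒InAND ∘ All.lookup minimal , found ∘ InAND⇒MinimalSpan
      where
      open Outputs (outputs-from (suc (μ (-∞ , -∞) 0)) ℕ.≤-refl initial)
      found : ∀ {I} → MinimalSpan I → I ∈ outputs
      found (k , full-k , refl , minimal-k) = complete k z≤n full-k minimal-k refl

mainTheorem5 : {O : Set} {_<_ : O → O → Set} (sto : IsStrictTotalOrder _≡_ _<_)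
    → let open AND sto in
    (n : ℕ) (A : Fin (suc n) → List⁺ Iv)
    → (∀ i → All NonEmptyIv (toList (A i)))
    → (∀ i → NatAntichain (toList (A i)))
    → (sel : Sel (suc n)) → TopSpec sel
    → Σ (List Iv) λ L →
    (Algo.calls sel (suc (length L)) (initState A) ≡ map (just ∘ liftIv) L ++ (nothing ∷ []))
    × Unique L
    × (∀ I → (I ∈ L → InAND A I) × (InAND A I → I ∈ L))
mainTheorem5 sto n A _ A-antichain sel sel-top = Run.enumerates-AND sto n A A-antichain sel sel-top
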